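{- Let $\mathbb{T},\mathbb{U}$ be geometric theories over a set $A$ and let $R=\{([\varphi]_{\mathbb{T}},[\psi]_{\mathbb{T}})\mid(\varphi\vdash\psi)\in\mathbb{T}\cup\mathbb{U}\}$, a binary relation on $\mathrm{Geom}(A)/\mathbb{T}$. Let $\overline R$ be the least congruence preorder on $\mathrm{Geom}(A)/\mathbb{T}$ containing $R$, and $\sim_{\overline R}$ the equivalence it induces ($a\sim b$ iff $a\,\overline R\,b$ and $b\,\overline R\,a$). Then $\mathrm{Geom}(A)/(\mathbb{T}\cup\mathbb{U})$ is isomorphic to the quotient of $\mathrm{Geom}(A)/\mathbb{T}$ by $\sim_{\overline R}$.
   Context: Conjunctive formulas: $\gamma::=p\ (p\in A)\mid\mathrm{true}\mid\gamma\wedge\gamma$; $\mathrm{Geom}(A)$ is the set of $\bigvee S$, $S$ an arbitrary set of conjunctive formulas; derived connectives: $\bigvee_i\varphi_i$ (union of underlying sets), $\varphi\wedge\psi$ (disjunction of pairwise conjunctions), $\mathrm{true}=\bigvee\{\mathrm{true}\}$. For a theory $\mathbb{T}$ (a set of sequents $\psi\vdash\varphi$), $\vdash_{\mathbb{T}}$ is the least relation closed under: $\varphi\vdash_{\mathbb{T}}\psi$ for $(\varphi\vdash\psi)\in\mathbb{T}$; reflexivity; transitivity; $\varphi\wedge\psi\vdash_{\mathbb{T}}\varphi$, $\varphi\wedge\psi\vdash_{\mathbb{T}}\psi$; from $\theta\vdash_{\mathbb{T}}\varphi$, $\theta\vdash_{\mathbb{T}}\psi$ infer $\theta\vdash_{\mathbb{T}}\varphi\wedge\psi$;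 $\varphi\vdash_{\mathbb{T}}\mathrm{true}$; from $\varphi_i\vdash_{\mathbb{T}}\psi$ for all $i$ infer $\bigvee_i\varphi_i\vdash_{\mathbb{T}}\psi$; $\varphi_i\vdash_{\mathbb{T}}\bigvee_i\varphi_i$. $\mathrm{Geom}(A)/\mathbb{T}$ is the quotient by mutual derivability, classes $[\varphi]_{\mathbb{T}}$, ordered by $\vdash_{\mathbb{T}}$ (a frame). A congruence preorder on a frame $(L,\le)$ is a preorder $\preceq$ containing $\le$ such that for every subset $S\subseteq L$, $\bigvee S\preceq b$ whenever $a\preceq b$ for all $a\in S$, and for every finite $S\subseteq L$, $b\preceq\bigwedge S$ whenever $b\preceq a$ for all $a\in S$. -}

module Defs where

open import Data.Unit using (⊤; tt)
open import Data.Product using (Σ; _×_; _,_; proj₁; proj₂)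
open import Data.Sum using (_⊎_)
open import Data.Nat using (ℕ; zero; suc)
open import Data.Fin using (Fin)
import Data.Fin as Fin

data Conj (A : Set) : Set where
  atom  : A → Conj A
  ctrue : Conj A
  _∧c_  : Conj A → Conj A → Conj A

-- Geometric formulas: ⋁ S for S an (arbitrary, Set-indexed) set of
-- conjunctive formulas, represented as an indexed family.
record Geom (A : Set) : Set₁ where
  constructor ⋁c
  field
    Idx  : Set
    disj : Idx → Conj A
open Geom public

module _ {A : Set} where

  ⋁ : {I : Set} → (I → Geom A) → Geom A
  ⋁ {I} φ = ⋁c (Σ I (λ i → Idx (φ i))) (λ p → disj (φ (proj₁ p)) (proj₂ p))

  _∧_ : Geom A → Geom A → Geom A
  φ ∧ ψ = ⋁c (Idx φ × Idx ψ) (λ p → disj φ (proj₁ p) ∧c disj ψ (proj₂ p))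

  true : Geom A
  true = ⋁c ⊤ (λ _ → ctrue)

  ⋀ : {n : ℕ} → (Fin n → Geom A) → Geom A
  ⋀ {zero}  φ = true
  ⋀ {suc n} φ = φ Fin.zero ∧ ⋀ (λ i → φ (Fin.suc i))

-- A theory: a set of sequents; T φ ψ means (φ ⊢ ψ) ∈ T.
Theory : Set → Set₁
Theory A = Geom A → Geom A → Set

_∪_ : {A : Set} → Theory A → Theory A → Theory A
(T ∪ U) φ ψ = T φ ψ ⊎ U φ ψ

data _⊢[_]_ {A : Set} : Geom A → Theory A → Geom A → Set₁ where
  ax     : ∀ {T φ ψ} → T φ ψ → φ ⊢[ T ] ψ
  refl⊢  : ∀ {T φ} → φ ⊢[ T ] φ
  trans⊢ : ∀ {T φ ψ χ} → φ ⊢[ T ] ψ → ψ ⊢[ T ] χ → φ ⊢[ T ] χ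
  ∧-π₁   : ∀ {T φ ψ} → (φ ∧ ψ) ⊢[ T ] φ
  ∧-π₂   : ∀ {T φ ψ} → (φ ∧ ψ) ⊢[ T ] ψ
  ∧-intro : ∀ {T θ φ ψ} → θ ⊢[ T ] φ → θ ⊢[ T ] ψ → θ ⊢[ T ] (φ ∧ ψ)
  true-intro : ∀ {T φ} → φ ⊢[ T ] true
  ⋁-elim : ∀ {T ψ} {I : Set} (φ : I → Geom A) → (∀ i → φ i ⊢[ T ] ψ) → ⋁ φ ⊢[ T ] ψ
  ⋁-intro : ∀ {T} {I : Set} (φ : I → Geom A) (i : I) → φ i ⊢[ T ] ⋁ φ

-- Mutual derivability (equality in Geom(A)/T).
_≡[_]_ : {A : Set} → Geom A → Theory A → Geom A → Set₁
φ ≡[ T ] ψ = (φ ⊢[ T ] ψ) × (ψ ⊢[ T ] φ)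

-- Relations on the frame Geom(A)/T, represented on representatives.
Rel₁ : Set → Set₂
Rel₁ A = Geom A → Geom A → Set₁

RelOf : {A : Set} → Theory A → Theory A → Rel₁ A
RelOf T U a b = Σ _ λ φ → Σ _ λ ψ → (T ∪ U) φ ψ × (a ≡[ T ] φ) × (b ≡[ T ] ψ)

record IsCongruencePreorder {A : Set} (T : Theory A) (_≼_ : Rel₁ A) : Set₁ where
  field
    ≼-refl  : ∀ {a} → a ≼ a
    ≼-trans : ∀ {a b c} → a ≼ b → b ≼ c → a ≼ c
    ≼-contains : ∀ {a b} → a ⊢[ T ] b → a ≼ b
    ≼-join : ∀ {I : Set} (S : I → Geom A) {b} → (∀ i → S i ≼ b) → ⋁ S ≼ b
    ≼-meet : ∀ {n : ℕ} (S : Fin n → Geom A) {b} → (∀ i → b ≼ S i) → b ≼ ⋀ S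

_⊆_ : {A : Set} → Rel₁ A → Rel₁ A → Set₁
R ⊆ S = ∀ {a b} → R a b → S a b

record IsLeastCongruencePreorderContaining {A : Set} (T : Theory A) (R Rbar : Rel₁ A) : Set₂ where
  field
    isCong   : IsCongruencePreorder T Rbar
    contains : R ⊆ Rbar
    least    : (S : Rel₁ A) → IsCongruencePreorder T S → R ⊆ S → Rbar ⊆ S

-- Isomorphism of the posets obtained by quotienting two preorders
-- (on carriers X, Y) by their induced equivalences.
record OrderIso {X Y : Set₁} (_≤₁_ : X → X → Set₁) (_≤₂_ : Y → Y → Set₁) : Set₁ where
  field
    to      : X → Y
    from    : Y → X
    to-mono   : ∀ {x x'} → x ≤₁ x' → to x ≤₂ to x'
    from-mono : ∀ {y y'} → y ≤₂ y' → from y ≤₁ from y'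
    from-to₁ : ∀ x → from (to x) ≤₁ x
    from-to₂ : ∀ x → x ≤₁ from (to x)
    to-from₁ : ∀ y → to (from y) ≤₂ y
    to-from₂ : ∀ y → y ≤₂ to (from y)

-- Every T ∪ U-derivation is
-- replayed inside any congruence preorder on Geom(A)/T containing R, since each
-- derivation rule is either a T-derivable sequent or an instance of the join/meet
-- closure; conversely ⊢_{T ∪ U} is itself such a congruence preorder, so it
-- contains the least one. Hence R̄ and ⊢_{T ∪ U} coincide and the identity is
-- the isomorphism.
module Submission where

open import Defs
open import Data.Nat using (ℕ; zero; suc)
open import Data.Fin using (Fin)
import Data.Fin as Fin
open import Data.Sum using (inj₁)
open import Data.Product using (_,_)

module _ {A : Set} where

  ⊢-mono : {T T′ : Theory A} → (∀ {φ ψ} → T φ ψ → T′ φ ψ)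
         → ∀ {φ ψ} → φ ⊢[ T ] ψ → φ ⊢[ T′ ] ψ
  ⊢-mono T⊆T′ (ax x)        = ax (T⊆T′ x)
  ⊢-mono T⊆T′ refl⊢         = refl⊢
  ⊢-mono T⊆T′ (trans⊢ p q)  = trans⊢ (⊢-mono T⊆T′ p) (⊢-mono T⊆T′ q)
  ⊢-mono T⊆T′ ∧-π₁          = ∧-π₁
  ⊢-mono T⊆T′ ∧-π₂          = ∧-π₂
  ⊢-mono T⊆T′ (∧-intro p q) = ∧-intro (⊢-mono T⊆T′ p) (⊢-mono T⊆T′ q)
  ⊢-mono T⊆T′ true-intro    = true-intro
  ⊢-mono T⊆T′ (⋁-elim φ f)  = ⋁-elim φ (λ i → ⊢-mono T⊆T′ (f i))
  ⊢-mono T⊆T′ (⋁-intro φ i) = ⋁-intro φ i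

  ⋀-intro : {T : Theory A} (n : ℕ) (S : Fin n → Geom A) {θ : Geom A}
          → (∀ i → θ ⊢[ T ] S i) → θ ⊢[ T ] ⋀ S
  ⋀-intro zero    S f = true-intro
  ⋀-intro (suc n) S f = ∧-intro (f Fin.zero) (⋀-intro n (λ i → S (Fin.suc i)) (λ i → f (Fin.suc i)))

  ⊢-isCongruencePreorder : {T T′ : Theory A} → (∀ {φ ψ} → T φ ψ → T′ φ ψ)
                         → IsCongruencePreorder T (λ φ ψ → φ ⊢[ T′ ] ψ)
  ⊢-isCongruencePreorder T⊆T′ = record
    { ≼-refl     = refl⊢
    ; ≼-trans    = trans⊢
    ; ≼-contains = ⊢-mono T⊆T′
    ; ≼-join     = λ S → ⋁-elim S
    ; ≼-meet     = λ {n} → ⋀-intro n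
    }

  module CongruencePreorder {T : Theory A} {_≼_ : Rel₁ A}
                            (isCong : IsCongruencePreorder T _≼_) where
    open IsCongruencePreorder isCong

    ≼-∧-intro : ∀ {θ φ ψ} → θ ≼ φ → θ ≼ ψ → θ ≼ (φ ∧ ψ)
    ≼-∧-intro {θ} {φ} {ψ} θ≼φ θ≼ψ =
      ≼-trans (≼-meet pair θ≼pair) (≼-contains (∧-intro ∧-π₁ (trans⊢ ∧-π₂ ∧-π₁)))
      where
      pair : Fin 2 → Geom A
      pair Fin.zero    = φ
      pair (Fin.suc _) = ψ

      θ≼pair : ∀ i → θ ≼ pair i
      θ≼pair Fin.zero           = θ≼φ
      θ≼pair (Fin.suc Fin.zero) = θ≼ψ

    ⊢⊆≼ : {T′ : Theory A} → (∀ {φ ψ} → T′ φ ψ → φ ≼ ψ)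
        → ∀ {φ ψ} → φ ⊢[ T′ ] ψ → φ ≼ ψ
    ⊢⊆≼ T′⊆≼ (ax x)        = T′⊆≼ x
    ⊢⊆≼ T′⊆≼ refl⊢         = ≼-refl
    ⊢⊆≼ T′⊆≼ (trans⊢ p q)  = ≼-trans (⊢⊆≼ T′⊆≼ p) (⊢⊆≼ T′⊆≼ q)
    ⊢⊆≼ T′⊆≼ ∧-π₁          = ≼-contains ∧-π₁
    ⊢⊆≼ T′⊆≼ ∧-π₂          = ≼-contains ∧-π₂
    ⊢⊆≼ T′⊆≼ (∧-intro p q) = ≼-∧-intro (⊢⊆≼ T′⊆≼ p) (⊢⊆≼ T′⊆≼ q)
    ⊢⊆≼ T′⊆≼ true-intro    = ≼-contains true-intro
    ⊢⊆≼ T′⊆≼ (⋁-elim φ f)  = ≼-join φ (λ i → ⊢⊆≼ T′⊆≼ (f i))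
    ⊢⊆≼ T′⊆≼ (⋁-intro φ i) = ≼-contains (⋁-intro φ i)

  RelOf⊆⊢ : (T U : Theory A) → RelOf T U ⊆ (λ φ ψ → φ ⊢[ T ∪ U ] ψ)
  RelOf⊆⊢ T U (_ , _ , φ⊢ψ , (a⊢φ , _) , (_ , ψ⊢b)) =
    trans⊢ (⊢-mono inj₁ a⊢φ) (trans⊢ (ax φ⊢ψ) (⊢-mono inj₁ ψ⊢b))

  ax∈RelOf : (T U : Theory A) → ∀ {φ ψ} → (T ∪ U) φ ψ → RelOf T U φ ψ
  ax∈RelOf T U φ⊢ψ = _ , _ , φ⊢ψ , (refl⊢ , refl⊢) , (refl⊢ , refl⊢)

mainTheorem16 : {A : Set} (T U : Theory A) (Rbar : Rel₁ A)
    → IsLeastCongruencePreorderContaining T (RelOf T U) Rbar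
    → OrderIso (λ φ ψ → φ ⊢[ T ∪ U ] ψ) Rbar
mainTheorem16 T U Rbar isLeast = record
  { to        = λ φ → φ
  ; from      = λ φ → φ
  ; to-mono   = ⊢⊆≼ (λ φ⊢ψ → contains (ax∈RelOf T U φ⊢ψ))
  ; from-mono = least _ (⊢-isCongruencePreorder inj₁) (RelOf⊆⊢ T U)
  ; from-to₁  = λ _ → refl⊢
  ; from-to₂  = λ _ → refl⊢
  ; to-from₁  = λ _ → ≼-refl
  ; to-from₂  = λ _ → ≼-refl
  }
  where
  open IsLeastCongruencePreorderContaining isLeast
  open IsCongruencePreorder isCong using (≼-refl)
  open CongruencePreorder isCong using (⊢⊆≼)
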